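{- Let $G$ be a finite noncyclic group with no maximal involutions, and let $\Gamma_G$ be its power graph. If there exists a prime $p$ dividing $|G|$ such that $G$ has more than one subgroup of order $p$, then $\mathrm{rc}(\Gamma_G)=3$.
   Context: For a finite group $G$, the power graph $\Gamma_G$ is the undirected graph with vertex set $G$ in which two distinct elements are adjacent if one is a power of the other. An involution is an element of order $2$. An involution $x$ is maximal if the only cyclic subgroup of $G$ containing $x$ is $\langle x\rangle$. For a connected graph $\Gamma$, an edge coloring $\zeta:E(\Gamma)\to\{1,\dots,k\}$ (adjacent edges may receive the same color) is a rainbow $k$-coloring if every pair of vertices is joined by a path whose edges have pairwise distinct colors; the rainbow connection number $\mathrm{rc}(\Gamma)$ is the minimum $k$ for which a rainbow $k$-coloring exists. -}

module Defs where

open import Level using (0ℓ)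
open import Data.Nat using (ℕ; zero; suc; _≤_; _<_)
open import Data.Nat.Divisibility using (_∣_)
open import Data.Nat.Primality using (Prime)
open import Data.Fin using (Fin)
open import Data.Fin.Subset using (Subset; _∈_; ∣_∣)
open import Data.List using (List; []; _∷_)
open import Data.List.Relation.Unary.Unique.Propositional using (Unique)
open import Data.Product using (Σ; ∃; ∃-syntax; _×_; _,_)
open import Data.Sum using (_⊎_)
open import Relation.Nullary using (¬_)
open import Relation.Binary.PropositionalEquality using (_≡_; _≢_)
open import Algebra.Structures using (IsGroup)

-- A finite group, presented (up to isomorphism) on the carrier Fin order,
-- with propositional equality.
record FiniteGroup : Set where
  field
    order   : ℕ
    _∙_     : Fin order → Fin order → Fin order
    ε       : Fin order
    _⁻¹     : Fin order → Fin order
    isGroup : IsGroup _≡_ _∙_ ε _⁻¹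

module _ (G : FiniteGroup) where
  open FiniteGroup G

  El : Set
  El = Fin order

  pow : El → ℕ → El
  pow x zero    = ε
  pow x (suc k) = x ∙ pow x k

  -- y is a power of x  (equivalently y ∈ ⟨x⟩, G finite)
  IsPowerOf : El → El → Set
  IsPowerOf y x = ∃[ k ] y ≡ pow x k

  HasOrder : El → ℕ → Set
  HasOrder x m = 0 < m × pow x m ≡ ε × (∀ j → 0 < j → pow x j ≡ ε → m ≤ j)

  IsCyclic : Set
  IsCyclic = ∃[ g ] (∀ x → IsPowerOf x g)

  IsInvolution : El → Set
  IsInvolution x = HasOrder x 2

  -- x is maximal: every cyclic subgroup ⟨y⟩ containing x equals ⟨x⟩
  -- (⟨y⟩ ∋ x gives ⟨x⟩ ⊆ ⟨y⟩; equality amounts to y ∈ ⟨x⟩)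
  IsMaximalInvolution : El → Set
  IsMaximalInvolution x =
    IsInvolution x × (∀ y → IsPowerOf x y → (∀ z → IsPowerOf z y → IsPowerOf z x))

  IsSubgroup : Subset order → Set
  IsSubgroup S = ε ∈ S × (∀ x y → x ∈ S → y ∈ S → (x ∙ y) ∈ S) × (∀ x → x ∈ S → (x ⁻¹) ∈ S)

  IsSubgroupOfOrder : ℕ → Subset order → Set
  IsSubgroupOfOrder p S = IsSubgroup S × ∣ S ∣ ≡ p

  PowerAdj : El → El → Set
  PowerAdj x y = x ≢ y × (IsPowerOf x y ⊎ IsPowerOf y x)

  data Walk : El → El → Set where
    []  : ∀ {u} → Walk u u
    _∷_ : ∀ {u w v} → PowerAdj u w → Walk w v → Walk u v

  -- edge colourings with colours Fin k (i.e. {1,…,k}); symmetric so that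
  -- the colour is a function of the undirected edge
  EdgeColouring : ℕ → Set
  EdgeColouring k = Σ (El → El → Fin k) λ c → ∀ x y → PowerAdj x y → c x y ≡ c y x

  colours : ∀ {k} → (El → El → Fin k) → ∀ {u v} → Walk u v → List (Fin k)
  colours c []                = []
  colours c (_∷_ {u} {w} _ p) = c u w ∷ colours c p

  IsRainbowColouring : (k : ℕ) → EdgeColouring k → Set
  IsRainbowColouring k (c , _) = ∀ u v → Σ (Walk u v) λ p → Unique (colours c p)

  RainbowColourable : ℕ → Set
  RainbowColourable k = Σ (EdgeColouring k) (IsRainbowColouring k)

  RainbowConnectionNumber : ℕ → Set
  RainbowConnectionNumber m = RainbowColourable m × (∀ k → k < m → ¬ RainbowColourable k)

-- Proposition 3.6.  If the finite group G has no maximal involutions and has two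
-- different subgroups of some prime order p, then rc(Γ_G) = 3.
--
-- rc ≤ 3: ε is adjacent to every vertex.  Colour each edge ε — v with 0 or 1 so
-- that v and v ⁻¹ differ whenever v ≠ v ⁻¹, and all other edges with 2.  Then
-- u — ε — v is rainbow unless u, v share their hub colour; in that case u has a
-- neighbour w ≠ ε of the other hub colour (w = u ⁻¹, or, for an involution u,
-- which is not maximal, w = y or y ⁻¹ for a larger cyclic ⟨y⟩ ∋ u), and
-- u — w — ε — v is rainbow.
--
-- rc ≥ 3: call u, v separated if they are distinct, non-adjacent and ε is their
-- only common neighbour.  With ≤ 2 colours a rainbow walk between separated
-- vertices is u — ε — v with two colours, so three pairwise separated vertices
-- exclude 1 and 2 colours.  Elements of order p generating different subgroups
-- are separated (a cyclic group has one subgroup of order p); two such, a and b,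
-- come from the given subgroups by Lagrange, and a third is a b a ⁻¹, b a b ⁻¹
-- or a b.
module Submission where

open import Level using (0ℓ)
open import Function using (_∘_)
open import Data.Empty using (⊥; ⊥-elim)
open import Data.Sum using (_⊎_; inj₁; inj₂; [_,_]′)
open import Data.Product using (Σ; ∃; ∃-syntax; _×_; _,_; proj₁; proj₂)
open import Relation.Nullary using (¬_; Dec; yes; no)
open import Relation.Nullary.Decidable using (_→-dec_; _×-dec_; ¬?)
open import Relation.Unary using (Decidable)
open import Relation.Binary.PropositionalEquality

open import Data.Nat using (ℕ; zero; suc; s≤s; z≤n; _+_; _*_; _∸_; _≤_; _<_; _<?_; NonZero; _%_; _/_; >-nonZero)
open import Data.Nat.Properties
  using (*-comm; *-zeroʳ; *-suc; +-comm; +-suc; n<1+n; <⇒≤; m<n⇒0<n∸m; m+[n∸m]≡n;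
         m<1+n⇒m<n∨m≡n; ≮⇒≥; ≤-refl; m∸n≤m; n≤0⇒n≡0; m<n⇒m<1+n; ≤-pred; +-monoʳ-≤;
         <-irrefl; <-trans; ≤-reflexive; module ≤-Reasoning)
open import Data.Nat.DivMod using (m≡m%n+[m/n]*n; m%n<n)
open import Data.Nat.Divisibility using (_∣_; divides; _∣0; ∣-refl; ∣m∣n⇒∣m+n)
open import Data.Nat.GCD using (gcd; gcd-GCD; gcd[m,n]∣m; gcd[m,n]∣n; c*gcd[m,n]≡gcd[cm,cn]; module Bézout)
open import Data.Nat.Coprimality using (Coprime; coprime-Bézout)
open import Data.Nat.Primality using (Prime; prime⇒irreducible)

open import Data.Fin using (Fin; zero; suc; toℕ; fromℕ<)
import Data.Fin as Fin
open import Data.Fin.Properties using (pigeonhole; any?; ¬∀⟶∃¬; toℕ-fromℕ<; _≟_)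
import Data.Fin.Properties as Finₚ
open import Data.Vec.Base using (_∷_; []; here; there)
open import Data.Fin.Subset using (Subset; inside; outside; _∈_; _∉_; _⊆_; _∪_; ⁅_⁆; _─_; ∣_∣)
  renaming (⊥ to ∅)
open import Data.Fin.Subset.Properties
  using (drop-∷-⊆; ∪-identityʳ; ∉⊥; ∣⊥∣≡0; x∈⁅x⁆; x∈⁅y⁆⇒x≡y; x∈p∪q⁻; x∈p∪q⁺;
         nonempty?; Empty-unique; p─q⊆p; x∈p∧x∉q⇒x∈p─q; _∈?_; ⊆-antisym; p⊂q⇒∣p∣<∣q∣)

open import Data.List.Relation.Unary.All using ([]; _∷_)
open import Data.List.Relation.Unary.AllPairs using ([]; _∷_)
open import Data.List.Relation.Unary.Unique.Propositional using (Unique)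
open import Algebra.Bundles using (Group)
open import Algebra.Structures using (IsGroup)

open import Defs

module _ (P : ℕ → Set) (P? : Decidable P) where

  private
    search : ∀ N → (∀ j → j < N → ¬ P j) ⊎ (∃ λ m → P m × (∀ j → j < m → ¬ P j))
    search zero = inj₁ (λ _ ())
    search (suc N) with search N
    ... | inj₂ witness = inj₂ witness
    ... | inj₁ ¬P<N with P? N
    ...   | yes PN = inj₂ (N , PN , ¬P<N)
    ...   | no ¬PN = inj₁ λ j j<1+N → [ ¬P<N j , (λ { refl → ¬PN }) ]′ (m<1+n⇒m<n∨m≡n j<1+N)

  least : ∀ N → P N → ∃ λ m → P m × (∀ j → j < m → ¬ P j)
  least N PN with search (suc N)
  ... | inj₁ ¬P≤N = ⊥-elim (¬P≤N N (n<1+n N) PN)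
  ... | inj₂ witness = witness

∣∪⁅⁆∣ : ∀ {m} (A : Subset m) z → z ∉ A → ∣ A ∪ ⁅ z ⁆ ∣ ≡ suc ∣ A ∣
∣∪⁅⁆∣ (outside ∷ A) zero    _   = cong suc (cong ∣_∣ (∪-identityʳ A))
∣∪⁅⁆∣ (inside  ∷ A) zero    z∉A = ⊥-elim (z∉A here)
∣∪⁅⁆∣ (outside ∷ A) (suc z) z∉A = ∣∪⁅⁆∣ A z (z∉A ∘ there)
∣∪⁅⁆∣ (inside  ∷ A) (suc z) z∉A = cong suc (∣∪⁅⁆∣ A z (z∉A ∘ there))

∣X∣≡∣X─A∣+∣A∣ : ∀ {m} (X A : Subset m) → A ⊆ X → ∣ X ∣ ≡ ∣ X ─ A ∣ + ∣ A ∣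
∣X∣≡∣X─A∣+∣A∣ []            []            _   = refl
∣X∣≡∣X─A∣+∣A∣ (inside  ∷ X) (inside  ∷ A) A⊆X =
  trans (cong suc (∣X∣≡∣X─A∣+∣A∣ X A (drop-∷-⊆ A⊆X))) (sym (+-suc _ _))
∣X∣≡∣X─A∣+∣A∣ (inside  ∷ X) (outside ∷ A) A⊆X = cong suc (∣X∣≡∣X─A∣+∣A∣ X A (drop-∷-⊆ A⊆X))
∣X∣≡∣X─A∣+∣A∣ (outside ∷ X) (inside  ∷ A) A⊆X with A⊆X here
... | ()
∣X∣≡∣X─A∣+∣A∣ (outside ∷ X) (outside ∷ A) A⊆X = ∣X∣≡∣X─A∣+∣A∣ X A (drop-∷-⊆ A⊆X)

x∈p─q⇒x∉q : ∀ {m} (X A : Subset m) {z} → z ∈ X ─ A → z ∉ A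
x∈p─q⇒x∉q (_      ∷ X) (inside  ∷ A) (there z∈X─A) (there z∈A) = x∈p─q⇒x∉q X A z∈X─A z∈A
x∈p─q⇒x∉q (_      ∷ X) (outside ∷ A) (there z∈X─A) (there z∈A) = x∈p─q⇒x∉q X A z∈X─A z∈A
x∈p─q⇒x∉q (inside ∷ X) (outside ∷ A) here ()

⊆-from-none-outside : ∀ {m} {A B : Subset m} → ¬ (∃ λ x → x ∈ A × x ∉ B) → A ⊆ B
⊆-from-none-outside {B = B} none {x} x∈A with x ∈? B
... | yes x∈B = x∈B
... | no  x∉B = ⊥-elim (none (x , x∈A , x∉B))

outside-element : ∀ {m} (A B : Subset m) → ∣ A ∣ ≡ ∣ B ∣ → A ≢ B → ∃ λ x → x ∈ A × x ∉ B
outside-element A B ∣A∣≡∣B∣ A≢B with any? (λ x → (x ∈? A) ×-dec ¬? (x ∈? B))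
... | yes A⊈B = A⊈B
... | no  A⊆B with any? (λ x → (x ∈? B) ×-dec ¬? (x ∈? A))
...   | yes B⊈A = ⊥-elim (<-irrefl ∣A∣≡∣B∣ (p⊂q⇒∣p∣<∣q∣ (⊆-from-none-outside A⊆B , B⊈A)))
...   | no  B⊆A = ⊥-elim (A≢B (⊆-antisym (⊆-from-none-outside A⊆B) (⊆-from-none-outside B⊆A)))

no-three-distinct : (i j k : Fin 2) → i ≢ j → j ≢ k → i ≢ k → ⊥
no-three-distinct zero       zero       _          i≢j _   _   = i≢j refl
no-three-distinct (suc zero) (suc zero) _          i≢j _   _   = i≢j refl
no-three-distinct zero       (suc zero) zero       _   _   i≢k = i≢k refl
no-three-distinct zero       (suc zero) (suc zero) _   j≢k _   = j≢k refl
no-three-distinct (suc zero) zero       zero       _   j≢k _   = j≢k refl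
no-three-distinct (suc zero) zero       (suc zero) _   _   i≢k = i≢k refl

one-differs : ∀ {n} {i j : Fin n} (c : Fin n) → i ≢ j → i ≢ c ⊎ j ≢ c
one-differs {i = i} c i≢j with i ≟ c
... | yes refl = inj₂ (i≢j ∘ sym)
... | no  i≢c  = inj₁ i≢c

prime∤⇒coprime : ∀ {p k} → Prime p → ¬ p ∣ k → Coprime k p
prime∤⇒coprime p-prime p∤k (d∣k , d∣p) with prime⇒irreducible p-prime d∣p
... | inj₁ d≡1  = d≡1
... | inj₂ refl = ⊥-elim (p∤k d∣k)

module _ (G : FiniteGroup) where
  open FiniteGroup G
  open IsGroup isGroup using (assoc; identityˡ; identityʳ; inverseʳ)

  groupBundle : Group 0ℓ 0ℓ
  groupBundle = record
    { Carrier = El G ; _≈_ = _≡_ ; _∙_ = _∙_ ; ε = ε ; _⁻¹ = _⁻¹ ; isGroup = isGroup }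

  open import Algebra.Properties.Group groupBundle public
    using (∙-cancelˡ; ∙-cancelʳ; inverseˡ-unique; inverseʳ-unique; ⁻¹-involutive;
           ⁻¹-injective; ε⁻¹≈ε; ⁻¹-anti-homo-∙; x∙y⁻¹≈ε⇒x≈y;
           \\-leftDividesʳ; //-rightDividesˡ; //-rightDividesʳ)

  infixr 8 _^_
  _^_ : El G → ℕ → El G
  _^_ = pow G

  infix 4 _∈⟨_⟩
  _∈⟨_⟩ : El G → El G → Set
  y ∈⟨ x ⟩ = IsPowerOf G y x

  ^-+ : ∀ x m n → x ^ (m + n) ≡ (x ^ m) ∙ (x ^ n)
  ^-+ x zero    n = sym (identityˡ _)
  ^-+ x (suc m) n = trans (cong (x ∙_) (^-+ x m n)) (sym (assoc _ _ _))

  ^-sucʳ : ∀ x n → x ^ suc n ≡ (x ^ n) ∙ x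
  ^-sucʳ x n = trans (cong (x ^_) (+-comm 1 n)) (trans (^-+ x n 1) (cong ((x ^ n) ∙_) (identityʳ x)))

  ^-* : ∀ x m n → (x ^ m) ^ n ≡ x ^ (m * n)
  ^-* x m zero    = cong (x ^_) (sym (*-zeroʳ m))
  ^-* x m (suc n) = begin
    (x ^ m) ∙ ((x ^ m) ^ n) ≡⟨ cong ((x ^ m) ∙_) (^-* x m n) ⟩
    (x ^ m) ∙ (x ^ (m * n)) ≡⟨ sym (^-+ x m (m * n)) ⟩
    x ^ (m + m * n)         ≡⟨ cong (x ^_) (sym (*-suc m n)) ⟩
    x ^ (m * suc n)         ∎
    where open ≡-Reasoning

  ε^ : ∀ n → ε ^ n ≡ ε
  ε^ zero    = refl
  ε^ (suc n) = trans (identityˡ _) (ε^ n)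

  ^-period-* : ∀ x {m} k → x ^ m ≡ ε → x ^ (k * m) ≡ ε
  ^-period-* x {m} k xᵐ≡ε = begin
    x ^ (k * m)   ≡⟨ cong (x ^_) (*-comm k m) ⟩
    x ^ (m * k)   ≡⟨ sym (^-* x m k) ⟩
    (x ^ m) ^ k   ≡⟨ cong (_^ k) xᵐ≡ε ⟩
    ε ^ k         ≡⟨ ε^ k ⟩
    ε             ∎
    where open ≡-Reasoning

  ^-mod : ∀ x n .{{_ : NonZero n}} → x ^ n ≡ ε → ∀ k → x ^ k ≡ x ^ (k % n)
  ^-mod x n xⁿ≡ε k = begin
    x ^ k                               ≡⟨ cong (x ^_) (m≡m%n+[m/n]*n k n) ⟩
    x ^ (k % n + (k / n) * n)           ≡⟨ ^-+ x (k % n) ((k / n) * n) ⟩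
    (x ^ (k % n)) ∙ (x ^ ((k / n) * n)) ≡⟨ cong ((x ^ (k % n)) ∙_) (^-period-* x (k / n) xⁿ≡ε) ⟩
    (x ^ (k % n)) ∙ ε                   ≡⟨ identityʳ _ ⟩
    x ^ (k % n)                         ∎
    where open ≡-Reasoning

  ^-equal⇒period : ∀ x {i j} → i ≤ j → x ^ i ≡ x ^ j → x ^ (j ∸ i) ≡ ε
  ^-equal⇒period x {i} {j} i≤j xⁱ≡xʲ = sym (∙-cancelˡ (x ^ i) _ _ (begin
    (x ^ i) ∙ ε               ≡⟨ identityʳ _ ⟩
    x ^ i                     ≡⟨ xⁱ≡xʲ ⟩
    x ^ j                     ≡⟨ cong (x ^_) (sym (m+[n∸m]≡n i≤j)) ⟩
    x ^ (i + (j ∸ i))         ≡⟨ ^-+ x i (j ∸ i) ⟩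
    (x ^ i) ∙ (x ^ (j ∸ i))   ∎))
    where open ≡-Reasoning

  ^-period-combination : ∀ w {d k l} s t → w ^ k ≡ ε → w ^ l ≡ ε → d + s * k ≡ t * l → w ^ d ≡ ε
  ^-period-combination w {d} {k} {l} s t wᵏ≡ε wˡ≡ε d+sk≡tl = begin
    w ^ d                     ≡⟨ sym (identityʳ _) ⟩
    (w ^ d) ∙ ε               ≡⟨ cong ((w ^ d) ∙_) (sym (^-period-* w s wᵏ≡ε)) ⟩
    (w ^ d) ∙ (w ^ (s * k))   ≡⟨ sym (^-+ w d (s * k)) ⟩
    w ^ (d + s * k)           ≡⟨ cong (w ^_) d+sk≡tl ⟩
    w ^ (t * l)               ≡⟨ ^-period-* w t wˡ≡ε ⟩
    ε                         ∎
    where open ≡-Reasoning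

  ^-gcd : ∀ w m n → w ^ m ≡ ε → w ^ n ≡ ε → w ^ gcd m n ≡ ε
  ^-gcd w m n wᵐ≡ε wⁿ≡ε with Bézout.identity (gcd-GCD m n)
  ... | Bézout.+- x y d+yn≡xm = ^-period-combination w y x wⁿ≡ε wᵐ≡ε d+yn≡xm
  ... | Bézout.-+ x y d+xm≡yn = ^-period-combination w x y wᵐ≡ε wⁿ≡ε d+xm≡yn

  conj : El G → El G → El G
  conj a b = (a ∙ b) ∙ (a ⁻¹)

  conj-ε : ∀ a → conj a ε ≡ ε
  conj-ε a = trans (cong (_∙ (a ⁻¹)) (identityʳ a)) (inverseʳ a)

  ^-conj : ∀ a b n → conj a b ^ n ≡ conj a (b ^ n)
  ^-conj a b zero    = sym (conj-ε a)
  ^-conj a b (suc n) = begin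
    conj a b ∙ (conj a b ^ n)                    ≡⟨ cong (conj a b ∙_) (^-conj a b n) ⟩
    conj a b ∙ ((a ∙ (b ^ n)) ∙ (a ⁻¹))          ≡⟨ sym (assoc _ _ _) ⟩
    (conj a b ∙ (a ∙ (b ^ n))) ∙ (a ⁻¹)          ≡⟨ cong (_∙ (a ⁻¹)) (assoc _ _ _) ⟩
    ((a ∙ b) ∙ ((a ⁻¹) ∙ (a ∙ (b ^ n)))) ∙ (a ⁻¹) ≡⟨ cong (λ t → ((a ∙ b) ∙ t) ∙ (a ⁻¹)) (\\-leftDividesʳ a (b ^ n)) ⟩
    ((a ∙ b) ∙ (b ^ n)) ∙ (a ⁻¹)                 ≡⟨ cong (_∙ (a ⁻¹)) (assoc _ _ _) ⟩
    conj a (b ^ suc n)                           ∎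
    where open ≡-Reasoning

  ^-∙-commuting : ∀ a b → a ∙ b ≡ b ∙ a → ∀ n → (a ∙ b) ^ n ≡ (a ^ n) ∙ (b ^ n)
  ^-∙-commuting a b ab≡ba zero    = sym (identityˡ ε)
  ^-∙-commuting a b ab≡ba (suc n) = begin
    (a ∙ b) ∙ ((a ∙ b) ^ n)        ≡⟨ cong ((a ∙ b) ∙_) (^-∙-commuting a b ab≡ba n) ⟩
    (a ∙ b) ∙ ((a ^ n) ∙ (b ^ n))  ≡⟨ assoc _ _ _ ⟩
    a ∙ (b ∙ ((a ^ n) ∙ (b ^ n)))  ≡⟨ cong (a ∙_) (sym (assoc _ _ _)) ⟩
    a ∙ ((b ∙ (a ^ n)) ∙ (b ^ n))  ≡⟨ cong (λ t → a ∙ (t ∙ (b ^ n))) (b-commutes n) ⟩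
    a ∙ (((a ^ n) ∙ b) ∙ (b ^ n))  ≡⟨ cong (a ∙_) (assoc _ _ _) ⟩
    a ∙ ((a ^ n) ∙ (b ∙ (b ^ n)))  ≡⟨ sym (assoc _ _ _) ⟩
    (a ∙ (a ^ n)) ∙ (b ∙ (b ^ n))  ∎
    where
    open ≡-Reasoning
    b-commutes : ∀ k → b ∙ (a ^ k) ≡ (a ^ k) ∙ b
    b-commutes zero    = trans (identityʳ b) (sym (identityˡ b))
    b-commutes (suc k) = begin
      b ∙ (a ∙ (a ^ k))   ≡⟨ sym (assoc _ _ _) ⟩
      (b ∙ a) ∙ (a ^ k)   ≡⟨ cong (_∙ (a ^ k)) (sym ab≡ba) ⟩
      (a ∙ b) ∙ (a ^ k)   ≡⟨ assoc _ _ _ ⟩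
      a ∙ (b ∙ (a ^ k))   ≡⟨ cong (a ∙_) (b-commutes k) ⟩
      a ∙ ((a ^ k) ∙ b)   ≡⟨ sym (assoc _ _ _) ⟩
      (a ∙ (a ^ k)) ∙ b   ∎

  IsPeriod : El G → ℕ → Set
  IsPeriod x n = 0 < n × x ^ n ≡ ε

  -- Every element of the finite group G has a positive period
  -- (pigeonhole on x ^ 0, …, x ^ order).
  period : ∀ x → ∃ (IsPeriod x)
  period x with pigeonhole (n<1+n order) (λ i → x ^ toℕ i)
  ... | i , j , i<j , xⁱ≡xʲ = toℕ j ∸ toℕ i , m<n⇒0<n∸m i<j , ^-equal⇒period x (<⇒≤ i<j) xⁱ≡xʲ

  ε∈⟨⟩ : ∀ x → ε ∈⟨ x ⟩
  ε∈⟨⟩ x = 0 , refl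

  ∈⟨⟩-refl : ∀ x → x ∈⟨ x ⟩
  ∈⟨⟩-refl x = 1 , sym (identityʳ x)

  ∈⟨⟩-∙ : ∀ {x y z} → y ∈⟨ x ⟩ → z ∈⟨ x ⟩ → (y ∙ z) ∈⟨ x ⟩
  ∈⟨⟩-∙ {x} (i , refl) (j , refl) = i + j , sym (^-+ x i j)

  ∈⟨⟩-trans : ∀ {x y z} → x ∈⟨ y ⟩ → y ∈⟨ z ⟩ → x ∈⟨ z ⟩
  ∈⟨⟩-trans {z = z} (i , refl) (j , refl) = j * i , ^-* z j i

  -- x ⁻¹ = x ^ (n - 1) for a positive period n of x.
  ⁻¹∈⟨⟩ : ∀ x → x ⁻¹ ∈⟨ x ⟩
  ⁻¹∈⟨⟩ x with period x
  ... | n , 0<n , xⁿ≡ε = n ∸ 1 , sym (inverseʳ-unique x _ x∙xⁿ⁻¹≡ε)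
    where
    x∙xⁿ⁻¹≡ε : x ∙ (x ^ (n ∸ 1)) ≡ ε
    x∙xⁿ⁻¹≡ε = trans (cong (x ^_) (m+[n∸m]≡n 0<n)) xⁿ≡ε

  ∈⟨⟩-⁻¹ : ∀ {x y} → y ∈⟨ x ⟩ → y ⁻¹ ∈⟨ x ⟩
  ∈⟨⟩-⁻¹ {y = y} y∈⟨x⟩ = ∈⟨⟩-trans (⁻¹∈⟨⟩ y) y∈⟨x⟩

  ∈⟨⁻¹⟩ : ∀ x → x ∈⟨ x ⁻¹ ⟩
  ∈⟨⁻¹⟩ x = subst (_∈⟨ x ⁻¹ ⟩) (⁻¹-involutive x) (⁻¹∈⟨⟩ (x ⁻¹))

  ^∈⟨^divisor⟩ : ∀ w {d i} → d ∣ i → w ^ i ∈⟨ w ^ d ⟩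
  ^∈⟨^divisor⟩ w {d} (divides q i≡qd) = q , trans (cong (w ^_) (trans i≡qd (*-comm q d))) (sym (^-* w d q))

  ∈⟨⟩-cancelˡ : ∀ {a b} → (a ∙ b) ∈⟨ a ⟩ → b ∈⟨ a ⟩
  ∈⟨⟩-cancelˡ {a} {b} ab∈⟨a⟩ = subst (_∈⟨ a ⟩) (\\-leftDividesʳ a b) (∈⟨⟩-∙ (⁻¹∈⟨⟩ a) ab∈⟨a⟩)

  ∈⟨⟩-cancelʳ : ∀ {a b} → (a ∙ b) ∈⟨ b ⟩ → a ∈⟨ b ⟩
  ∈⟨⟩-cancelʳ {a} {b} ab∈⟨b⟩ = subst (_∈⟨ b ⟩) (//-rightDividesʳ b a) (∈⟨⟩-∙ ab∈⟨b⟩ (⁻¹∈⟨⟩ b))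

  conj-∙ : ∀ a b → conj a b ∙ a ≡ a ∙ b
  conj-∙ a b = //-rightDividesˡ a (a ∙ b)

  conj-∈⟨⟩ : ∀ {a b} → conj a b ∈⟨ a ⟩ → b ∈⟨ a ⟩
  conj-∈⟨⟩ {a} {b} c∈⟨a⟩ = ∈⟨⟩-cancelˡ (subst (_∈⟨ a ⟩) (conj-∙ a b) (∈⟨⟩-∙ c∈⟨a⟩ (∈⟨⟩-refl a)))

  commutator : ∀ a b → conj a b ∙ (b ⁻¹) ≡ a ∙ (conj b a ⁻¹)
  commutator a b = begin
    ((a ∙ b) ∙ (a ⁻¹)) ∙ (b ⁻¹)        ≡⟨ assoc _ _ _ ⟩
    (a ∙ b) ∙ ((a ⁻¹) ∙ (b ⁻¹))        ≡⟨ assoc _ _ _ ⟩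
    a ∙ (b ∙ ((a ⁻¹) ∙ (b ⁻¹)))        ≡⟨ cong (a ∙_) (sym (cong₂ _∙_ (⁻¹-involutive b) (⁻¹-anti-homo-∙ b a))) ⟩
    a ∙ (((b ⁻¹) ⁻¹) ∙ ((b ∙ a) ⁻¹))   ≡⟨ cong (a ∙_) (sym (⁻¹-anti-homo-∙ (b ∙ a) (b ⁻¹))) ⟩
    a ∙ (conj b a ⁻¹)                  ∎
    where open ≡-Reasoning

  ⁻¹≢ε : ∀ {u} → u ≢ ε → u ⁻¹ ≢ ε
  ⁻¹≢ε u≢ε u⁻¹≡ε = u≢ε (⁻¹-injective (trans u⁻¹≡ε (sym ε⁻¹≈ε)))

  ∉⟨⟩⇒≢ε : ∀ {a c} → ¬ c ∈⟨ a ⟩ → c ≢ ε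
  ∉⟨⟩⇒≢ε {a} c∉⟨a⟩ refl = c∉⟨a⟩ (ε∈⟨⟩ a)

  -- Membership in a cyclic subgroup is decidable: search the powers below a period.
  _∈⟨_⟩? : ∀ y x → Dec (y ∈⟨ x ⟩)
  y ∈⟨ x ⟩? with period x
  ... | n , 0<n , xⁿ≡ε with any? (λ (i : Fin n) → y ≟ x ^ toℕ i)
  ...   | yes (i , y≡xⁱ) = yes (toℕ i , y≡xⁱ)
  ...   | no ∄i = no λ (k , y≡xᵏ) → ∄i (fromℕ< (m%n<n k n) , reduce k y≡xᵏ)
    where
    instance
      _ : NonZero n
      _ = >-nonZero 0<n
    reduce : ∀ k → y ≡ x ^ k → y ≡ x ^ toℕ (fromℕ< (m%n<n k n))
    reduce k y≡xᵏ = trans y≡xᵏ (trans (^-mod x n xⁿ≡ε k) (cong (x ^_) (sym (toℕ-fromℕ< (m%n<n k n)))))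

  elementOrder : ∀ x → ∃ (HasOrder G x)
  elementOrder x with period x
  ... | N , N-period with least (IsPeriod x) (λ k → (0 <? k) ×-dec (x ^ k ≟ ε)) N N-period
  ...   | n , (0<n , xⁿ≡ε) , below = n , 0<n , xⁿ≡ε , λ j 0<j xʲ≡ε → ≮⇒≥ λ j<n → below j j<n (0<j , xʲ≡ε)

  -- Lagrange's theorem for ⟨a⟩ acting by right multiplication: the order n of a
  -- divides the size of every subset closed under z ↦ z ∙ a, since such a subset
  -- splits into orbits { y ∙ a ^ i | i < n } of exactly n elements.
  module Orbits (a : El G) {n : ℕ} (orderₐ : HasOrder G a n) where
    private
      0<n : 0 < n
      0<n = proj₁ orderₐ
      aⁿ≡ε : a ^ n ≡ ε
      aⁿ≡ε = proj₁ (proj₂ orderₐ)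

    ^-injective : ∀ {i j} → i < j → j < n → a ^ i ≢ a ^ j
    ^-injective {i} {j} i<j j<n aⁱ≡aʲ = <-irrefl refl (begin-strict
      n       ≤⟨ proj₂ (proj₂ orderₐ) (j ∸ i) (m<n⇒0<n∸m i<j) (^-equal⇒period a (<⇒≤ i<j) aⁱ≡aʲ) ⟩
      j ∸ i   ≤⟨ m∸n≤m j i ⟩
      j       <⟨ j<n ⟩
      n       ∎)
      where open ≤-Reasoning

    orbit : El G → ℕ → Subset order
    orbit y zero    = ∅
    orbit y (suc m) = orbit y m ∪ ⁅ y ∙ (a ^ m) ⁆

    ∈orbit⁻ : ∀ y m {z} → z ∈ orbit y m → ∃ λ i → i < m × z ≡ y ∙ (a ^ i)
    ∈orbit⁻ y zero    z∈orbit = ⊥-elim (∉⊥ z∈orbit)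
    ∈orbit⁻ y (suc m) z∈orbit with x∈p∪q⁻ (orbit y m) _ z∈orbit
    ... | inj₁ z∈orbitₘ = let (i , i<m , z≡y∙aⁱ) = ∈orbit⁻ y m z∈orbitₘ in i , m<n⇒m<1+n i<m , z≡y∙aⁱ
    ... | inj₂ z∈⁅y∙aᵐ⁆ = m , n<1+n m , x∈⁅y⁆⇒x≡y _ z∈⁅y∙aᵐ⁆

    ∈orbit⁺ : ∀ y m {i} → i < m → (y ∙ (a ^ i)) ∈ orbit y m
    ∈orbit⁺ y (suc m) i<1+m with m<1+n⇒m<n∨m≡n i<1+m
    ... | inj₁ i<m  = x∈p∪q⁺ (inj₁ (∈orbit⁺ y m i<m))
    ... | inj₂ refl = x∈p∪q⁺ {p = orbit y m} (inj₂ (x∈⁅x⁆ _))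

    ∣orbit∣ : ∀ y m → m ≤ n → ∣ orbit y m ∣ ≡ m
    ∣orbit∣ y zero    _     = ∣⊥∣≡0 order
    ∣orbit∣ y (suc m) 1+m≤n = trans (∣∪⁅⁆∣ (orbit y m) _ new) (cong suc (∣orbit∣ y m (<⇒≤ 1+m≤n)))
      where
      new : (y ∙ (a ^ m)) ∉ orbit y m
      new y∙aᵐ∈orbit with ∈orbit⁻ y m y∙aᵐ∈orbit
      ... | i , i<m , y∙aᵐ≡y∙aⁱ = ^-injective i<m 1+m≤n (sym (∙-cancelˡ y _ _ y∙aᵐ≡y∙aⁱ))

    ^-pred : ∀ {i} → i < n → ∃ λ i′ → i′ < n × a ^ i ≡ (a ^ i′) ∙ a
    ^-pred {zero}  _     = n ∸ 1 , ≤-reflexive 1+[n∸1]≡n , (begin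
      ε                   ≡⟨ sym aⁿ≡ε ⟩
      a ^ n               ≡⟨ cong (a ^_) (sym 1+[n∸1]≡n) ⟩
      a ^ suc (n ∸ 1)     ≡⟨ ^-sucʳ a (n ∸ 1) ⟩
      (a ^ (n ∸ 1)) ∙ a   ∎)
      where
      open ≡-Reasoning
      1+[n∸1]≡n : suc (n ∸ 1) ≡ n
      1+[n∸1]≡n = m+[n∸m]≡n 0<n
    ^-pred {suc i} 1+i<n = i , <-trans (n<1+n i) 1+i<n , ^-sucʳ a i

    orbit-closed⁻ : ∀ y {z} → (z ∙ a) ∈ orbit y n → z ∈ orbit y n
    orbit-closed⁻ y {z} z∙a∈orbit with ∈orbit⁻ y n z∙a∈orbit
    ... | i , i<n , z∙a≡y∙aⁱ with ^-pred i<n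
    ...   | i′ , i′<n , aⁱ≡aⁱ′∙a = subst (_∈ orbit y n) (sym z≡y∙aⁱ′) (∈orbit⁺ y n i′<n)
      where
      z≡y∙aⁱ′ : z ≡ y ∙ (a ^ i′)
      z≡y∙aⁱ′ = ∙-cancelʳ a _ _ (trans z∙a≡y∙aⁱ (trans (cong (y ∙_) aⁱ≡aⁱ′∙a) (sym (assoc _ _ _))))

    orbit⊆ : ∀ {X y} → (∀ {z} → z ∈ X → (z ∙ a) ∈ X) → y ∈ X → orbit y n ⊆ X
    orbit⊆ {X} {y} closed y∈X z∈orbit with ∈orbit⁻ y n z∈orbit
    ... | i , _ , refl = y∙aⁱ∈X i
      where
      y∙aⁱ∈X : ∀ i → (y ∙ (a ^ i)) ∈ X
      y∙aⁱ∈X zero    = subst (_∈ X) (sym (identityʳ y)) y∈X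
      y∙aⁱ∈X (suc i) = subst (_∈ X) (trans (assoc _ _ _) (cong (y ∙_) (sym (^-sucʳ a i)))) (closed (y∙aⁱ∈X i))

    order∣size : ∀ N (X : Subset order) → ∣ X ∣ ≤ N → (∀ {z} → z ∈ X → (z ∙ a) ∈ X) → n ∣ ∣ X ∣
    order∣size zero    X ∣X∣≤0   _      = subst (n ∣_) (sym (n≤0⇒n≡0 ∣X∣≤0)) (n ∣0)
    order∣size (suc N) X ∣X∣≤1+N closed with nonempty? X
    ... | no empty = subst (n ∣_) (sym (trans (cong ∣_∣ (Empty-unique empty)) (∣⊥∣≡0 order))) (n ∣0)
    ... | yes (y , y∈X) =
      subst (n ∣_) (sym ∣X∣≡∣X─C∣+n) (∣m∣n⇒∣m+n (order∣size N (X ─ C) ∣X─C∣≤N closed′) ∣-refl)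
      where
      C : Subset order
      C = orbit y n
      ∣X∣≡∣X─C∣+n : ∣ X ∣ ≡ ∣ X ─ C ∣ + n
      ∣X∣≡∣X─C∣+n = trans (∣X∣≡∣X─A∣+∣A∣ X C (orbit⊆ closed y∈X)) (cong (∣ X ─ C ∣ +_) (∣orbit∣ y n ≤-refl))
      ∣X─C∣≤N : ∣ X ─ C ∣ ≤ N
      ∣X─C∣≤N = ≤-pred (begin
        suc ∣ X ─ C ∣   ≡⟨ +-comm 1 _ ⟩
        ∣ X ─ C ∣ + 1   ≤⟨ +-monoʳ-≤ ∣ X ─ C ∣ 0<n ⟩
        ∣ X ─ C ∣ + n   ≡⟨ sym ∣X∣≡∣X─C∣+n ⟩
        ∣ X ∣           ≤⟨ ∣X∣≤1+N ⟩
        suc N           ∎)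
        where open ≤-Reasoning
      closed′ : ∀ {z} → z ∈ X ─ C → (z ∙ a) ∈ X ─ C
      closed′ z∈X─C = x∈p∧x∉q⇒x∈p─q (closed (p─q⊆p X C z∈X─C)) (x∈p─q⇒x∉q X C z∈X─C ∘ orbit-closed⁻ y)

  ^∈subgroup : ∀ {S} → IsSubgroup G S → ∀ {a} → a ∈ S → ∀ k → (a ^ k) ∈ S
  ^∈subgroup (ε∈S , _   , _) a∈S zero    = ε∈S
  ^∈subgroup S≤G@(_ , ∙∈S , _) a∈S (suc k) = ∙∈S _ _ a∈S (^∈subgroup S≤G a∈S k)

  lagrange : ∀ {S} → IsSubgroup G S → ∀ {a} → a ∈ S → a ^ ∣ S ∣ ≡ ε
  lagrange {S} (_ , ∙∈S , _) {a} a∈S with elementOrder a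
  ... | n , orderₐ with Orbits.order∣size a orderₐ ∣ S ∣ S ≤-refl (λ z∈S → ∙∈S _ _ z∈S a∈S)
  ...   | divides q ∣S∣≡q*n = trans (cong (a ^_) ∣S∣≡q*n) (^-period-* a q (proj₁ (proj₂ orderₐ)))

  -- u and v are distinct and non-adjacent in Γ_G, and ε is their only common
  -- neighbour; so every walk from u to v other than u — ε — v has ≥ 3 edges.
  Separated : El G → El G → Set
  Separated u v = u ≢ v × ¬ PowerAdj G u v × (∀ w → PowerAdj G u w → PowerAdj G w v → w ≡ ε)

  -- ε is adjacent to every other vertex, so a vertex separated from u is not ε.
  separated⇒≢ε : ∀ {u v} → Separated u v → v ≢ ε
  separated⇒≢ε {u} (u≢v , ¬u~v , _) refl = ¬u~v (u≢v , inj₂ (ε∈⟨⟩ u))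

  -- With a single colour a rainbow walk has at most one edge.
  one-colour : ∀ {u v} → Separated u v → (c : El G → El G → Fin 1) →
               (w : Walk G u v) → ¬ Unique (colours G c w)
  one-colour (u≢v , _)   c []           _                  = u≢v refl
  one-colour (_ , ¬u~v , _) c (u~v ∷ []) _                 = ¬u~v u~v
  one-colour _ c (_ ∷ _ ∷ _) ((c₁≢c₂ ∷ _) ∷ _) = c₁≢c₂ (Fin1-equal _ _)
    where
    Fin1-equal : (i j : Fin 1) → i ≡ j
    Fin1-equal zero zero = refl

  -- With two colours a rainbow walk has at most two edges, so between separated
  -- vertices it is u — ε — v and its two colours differ.
  two-colours : ∀ {u v} → Separated u v → (c : El G → El G → Fin 2) →
                (w : Walk G u v) → Unique (colours G c w) → c u ε ≢ c ε v
  two-colours (u≢v , _) c [] _ = ⊥-elim (u≢v refl)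
  two-colours (_ , ¬u~v , _) c (u~v ∷ []) _ = ⊥-elim (¬u~v u~v)
  two-colours {u} {v} (_ , _ , only-ε) c (_∷_ {w = m} u~m (m~v ∷ [])) ((c₁≢c₂ ∷ _) ∷ _) =
    subst (λ m → c u m ≢ c m v) (only-ε m u~m m~v) c₁≢c₂
  two-colours _ c (_ ∷ _ ∷ _ ∷ _) ((c₁≢c₂ ∷ c₁≢c₃ ∷ _) ∷ (c₂≢c₃ ∷ _) ∷ _) =
    ⊥-elim (no-three-distinct _ _ _ c₁≢c₂ c₂≢c₃ c₁≢c₃)

  -- Lower bound: three pairwise separated vertices leave no rainbow colouring
  -- with fewer than 3 colours (with 2 colours, the hub edges x — ε, y — ε,
  -- z — ε would need pairwise different colours).
  no-rainbow-below-3 : ∀ {x y z} → Separated x y → Separated y z → Separated x z →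
                       ∀ k → k < 3 → ¬ RainbowColourable G k
  no-rainbow-below-3 _ _ _ zero _ ((c , _) , _) with c ε ε
  ... | ()
  no-rainbow-below-3 {x} {y} sep-xy _ _ 1 _ ((c , _) , rainbow) =
    one-colour sep-xy c (proj₁ (rainbow x y)) (proj₂ (rainbow x y))
  no-rainbow-below-3 {x} {y} {z} sep-xy sep-yz sep-xz 2 _ ((c , symmetric) , rainbow) =
    no-three-distinct (c x ε) (c y ε) (c z ε) (hub-colours-differ sep-xy) (hub-colours-differ sep-yz)
      (hub-colours-differ sep-xz)
    where
    hub-colours-differ : ∀ {u v} → Separated u v → c u ε ≢ c v ε
    hub-colours-differ {u} {v} sep-uv cᵤ≡cᵥ =
      two-colours sep-uv c (proj₁ (rainbow u v)) (proj₂ (rainbow u v))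
        (trans cᵤ≡cᵥ (symmetric v ε (separated⇒≢ε sep-uv , inj₂ (ε∈⟨⟩ v))))
  no-rainbow-below-3 _ _ _ (suc (suc (suc _))) (s≤s (s≤s (s≤s ()))) _

  -- Upper bound.  Hub edges ε — v get colour 0 or 1 according to whether v
  -- precedes v ⁻¹ in the enumeration of G; all other edges get colour 2.
  hubColour : El G → Fin 3
  hubColour v with v Finₚ.<? v ⁻¹
  ... | yes _ = zero
  ... | no  _ = suc zero

  hubColour≢2 : ∀ v → hubColour v ≢ suc (suc zero)
  hubColour≢2 v with v Finₚ.<? v ⁻¹
  ... | yes _ = λ ()
  ... | no  _ = λ ()

  hubColour-⁻¹ : ∀ v → v ≢ v ⁻¹ → hubColour v ≢ hubColour (v ⁻¹)
  hubColour-⁻¹ v v≢v⁻¹ with v Finₚ.<? v ⁻¹ | v ⁻¹ Finₚ.<? v ⁻¹ ⁻¹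
  ... | yes v<v⁻¹ | yes v⁻¹<v⁻¹⁻¹ = λ _ → Finₚ.<-asym v<v⁻¹ (subst (v ⁻¹ Fin.<_) (⁻¹-involutive v) v⁻¹<v⁻¹⁻¹)
  ... | no  v≮v⁻¹ | no  v⁻¹≮v⁻¹⁻¹ = λ _ → v≢v⁻¹ (Finₚ.≤-antisym
          (subst (Fin._≤ v ⁻¹) (⁻¹-involutive v) (≮⇒≥ v⁻¹≮v⁻¹⁻¹)) (≮⇒≥ v≮v⁻¹))
  ... | yes _     | no  _          = λ ()
  ... | no  _     | yes _          = λ ()

  colouring : El G → El G → Fin 3
  colouring x y with x ≟ ε | y ≟ ε
  ... | yes _ | _     = hubColour y
  ... | no  _ | yes _ = hubColour x
  ... | no  _ | no  _ = suc (suc zero)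

  colouring-sym : ∀ x y → colouring x y ≡ colouring y x
  colouring-sym x y with x ≟ ε | y ≟ ε
  ... | yes refl | yes refl = refl
  ... | yes _    | no  _    = refl
  ... | no  _    | yes _    = refl
  ... | no  _    | no  _    = refl

  colouring-from-ε : ∀ v → colouring ε v ≡ hubColour v
  colouring-from-ε v with ε ≟ ε
  ... | yes _   = refl
  ... | no ε≢ε = ⊥-elim (ε≢ε refl)

  colouring-to-ε : ∀ {v} → v ≢ ε → colouring v ε ≡ hubColour v
  colouring-to-ε {v} v≢ε = trans (colouring-sym v ε) (colouring-from-ε v)

  colouring-off-ε : ∀ {x y} → x ≢ ε → y ≢ ε → colouring x y ≡ suc (suc zero)
  colouring-off-ε {x} {y} x≢ε y≢ε with x ≟ ε | y ≟ ε
  ... | yes x≡ε | _       = ⊥-elim (x≢ε x≡ε)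
  ... | no  _   | yes y≡ε = ⊥-elim (y≢ε y≡ε)
  ... | no  _   | no  _   = refl

  ∈⟨self-inverse⟩ : ∀ {y z} → y ⁻¹ ≡ y → z ∈⟨ y ⟩ → z ≡ ε ⊎ z ≡ y
  ∈⟨self-inverse⟩ {y} y⁻¹≡y (zero , refl) = inj₁ refl
  ∈⟨self-inverse⟩ {y} y⁻¹≡y (suc k , refl) with ∈⟨self-inverse⟩ y⁻¹≡y (k , refl)
  ... | inj₁ yᵏ≡ε = inj₂ (trans (cong (y ∙_) yᵏ≡ε) (identityʳ y))
  ... | inj₂ yᵏ≡y = inj₁ (trans (cong (y ∙_) (trans yᵏ≡y (sym y⁻¹≡y))) (inverseʳ y))

  self-inverse⇒involution : ∀ {u} → u ≢ ε → u ⁻¹ ≡ u → IsInvolution G u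
  self-inverse⇒involution {u} u≢ε u⁻¹≡u = s≤s z≤n , u²≡ε , minimal
    where
    u²≡ε : u ^ 2 ≡ ε
    u²≡ε = trans (cong (u ∙_) (trans (identityʳ u) (sym u⁻¹≡u))) (inverseʳ u)
    minimal : ∀ j → 0 < j → u ^ j ≡ ε → 2 ≤ j
    minimal 1 _ u¹≡ε = ⊥-elim (u≢ε (trans (sym (identityʳ u)) u¹≡ε))
    minimal (suc (suc j)) _ _ = s≤s (s≤s z≤n)

  larger-cyclic-subgroup : ∀ {u} → IsInvolution G u → ¬ IsMaximalInvolution G u → ∃ λ y → u ∈⟨ y ⟩ × ¬ y ∈⟨ u ⟩
  larger-cyclic-subgroup {u} involution ¬maximal = strict (¬∀⟶∃¬ order SameOrSmaller sameOrSmaller? ¬∀sameOrSmaller)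
    where
    SameOrSmaller : El G → Set
    SameOrSmaller y = u ∈⟨ y ⟩ → y ∈⟨ u ⟩
    sameOrSmaller? : Decidable SameOrSmaller
    sameOrSmaller? y = (u ∈⟨ y ⟩?) →-dec (y ∈⟨ u ⟩?)
    ¬∀sameOrSmaller : ¬ (∀ y → SameOrSmaller y)
    ¬∀sameOrSmaller all = ¬maximal (involution , λ y u∈⟨y⟩ z z∈⟨y⟩ → ∈⟨⟩-trans z∈⟨y⟩ (all y u∈⟨y⟩))
    strict : (∃ λ y → ¬ SameOrSmaller y) → ∃ λ y → u ∈⟨ y ⟩ × ¬ y ∈⟨ u ⟩
    strict (y , ¬sameOrSmaller) with u ∈⟨ y ⟩? | y ∈⟨ u ⟩?
    ... | yes u∈⟨y⟩ | no y∉⟨u⟩ = y , u∈⟨y⟩ , y∉⟨u⟩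
    ... | no u∉⟨y⟩  | _         = ⊥-elim (¬sameOrSmaller (⊥-elim ∘ u∉⟨y⟩))
    ... | _         | yes y∈⟨u⟩ = ⊥-elim (¬sameOrSmaller (λ _ → y∈⟨u⟩))

  larger-cyclic-neighbours : ∀ {u y} → u ≢ ε → u ∈⟨ y ⟩ → ¬ y ∈⟨ u ⟩ →
    y ≢ ε × y ≢ y ⁻¹ × PowerAdj G u y × PowerAdj G u (y ⁻¹)
  larger-cyclic-neighbours {u} {y} u≢ε u∈⟨y⟩ y∉⟨u⟩ =
    ∉⟨⟩⇒≢ε y∉⟨u⟩ , y≢y⁻¹ , (u≢y , inj₁ u∈⟨y⟩) , (u≢y⁻¹ , inj₁ (∈⟨⟩-trans u∈⟨y⟩ (∈⟨⁻¹⟩ y)))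
    where
    u≢y : u ≢ y
    u≢y refl = y∉⟨u⟩ (∈⟨⟩-refl u)
    u≢y⁻¹ : u ≢ y ⁻¹
    u≢y⁻¹ refl = y∉⟨u⟩ (subst (_∈⟨ y ⁻¹ ⟩) (⁻¹-involutive y) (⁻¹∈⟨⟩ (y ⁻¹)))
    y≢y⁻¹ : y ≢ y ⁻¹
    y≢y⁻¹ y≡y⁻¹ = [ u≢ε , u≢y ]′ (∈⟨self-inverse⟩ (sym y≡y⁻¹) u∈⟨y⟩)

  -- Without maximal involutions every u ≠ ε has a neighbour w ≠ ε of another hub
  -- colour: w = u ⁻¹ if u ≠ u ⁻¹; otherwise u is an involution in a larger ⟨y⟩,
  -- and one of y, y ⁻¹ (which have different hub colours) works.
  recolouring-neighbour : (∀ x → ¬ IsMaximalInvolution G x) →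
    ∀ {u} → u ≢ ε → ∃ λ w → w ≢ ε × PowerAdj G u w × hubColour w ≢ hubColour u
  recolouring-neighbour noMaximal {u} u≢ε with u ≟ u ⁻¹
  ... | no u≢u⁻¹ = u ⁻¹ , ⁻¹≢ε u≢ε , (u≢u⁻¹ , inj₂ (⁻¹∈⟨⟩ u)) , hubColour-⁻¹ u u≢u⁻¹ ∘ sym
  ... | yes u≡u⁻¹ = from-larger (larger-cyclic-subgroup (self-inverse⇒involution u≢ε (sym u≡u⁻¹)) (noMaximal u))
    where
    from-larger : (∃ λ y → u ∈⟨ y ⟩ × ¬ y ∈⟨ u ⟩) →
                  ∃ λ w → w ≢ ε × PowerAdj G u w × hubColour w ≢ hubColour u
    from-larger (y , u∈⟨y⟩ , y∉⟨u⟩) with larger-cyclic-neighbours u≢ε u∈⟨y⟩ y∉⟨u⟩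
    ... | y≢ε , y≢y⁻¹ , u~y , u~y⁻¹ =
      [ (λ y-differs → y , y≢ε , u~y , y-differs) , (λ y⁻¹-differs → y ⁻¹ , ⁻¹≢ε y≢ε , u~y⁻¹ , y⁻¹-differs) ]′
        (one-differs (hubColour u) (hubColour-⁻¹ y y≢y⁻¹))

  RainbowWalk : El G → El G → Set
  RainbowWalk u v = Σ (Walk G u v) λ p → Unique (colours G colouring p)

  via-ε : ∀ {u v} → u ≢ ε → v ≢ ε → hubColour u ≢ hubColour v → RainbowWalk u v
  via-ε {u} {v} u≢ε v≢ε differ =
    (u≢ε , inj₂ (ε∈⟨⟩ u)) ∷ (v≢ε ∘ sym , inj₁ (ε∈⟨⟩ v)) ∷ [] ,
    (differ ∘ hub-colours ∷ []) ∷ [] ∷ []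
    where
    hub-colours : colouring u ε ≡ colouring ε v → hubColour u ≡ hubColour v
    hub-colours eq = trans (sym (colouring-to-ε u≢ε)) (trans eq (colouring-from-ε v))

  -- u — w — ε — v, coloured 2, hub w, hub v.
  via-neighbour : ∀ {u w v} → u ≢ ε → w ≢ ε → v ≢ ε → PowerAdj G u w →
                  hubColour w ≢ hubColour v → RainbowWalk u v
  via-neighbour {u} {w} {v} u≢ε w≢ε v≢ε u~w differ =
    u~w ∷ proj₁ (via-ε w≢ε v≢ε differ) ,
    (hubColour≢2 w ∘ off-hub-vs (colouring-to-ε w≢ε) ∷ hubColour≢2 v ∘ off-hub-vs (colouring-from-ε v) ∷ []) ∷
    proj₂ (via-ε w≢ε v≢ε differ)
    where
    off-hub-vs : ∀ {e h} → e ≡ h → colouring u w ≡ e → h ≡ suc (suc zero)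
    off-hub-vs e≡h uw≡e = trans (sym e≡h) (trans (sym uw≡e) (colouring-off-ε u≢ε w≢ε))

  -- Between u, v ≠ ε: u — ε — v if their hub colours differ, otherwise go
  -- through a recolouring neighbour w of u, whose hub colour then differs from v's.
  rainbow-off-ε : (∀ x → ¬ IsMaximalInvolution G x) → ∀ {u v} → u ≢ ε → v ≢ ε → RainbowWalk u v
  rainbow-off-ε noMaximal u≢ε v≢ε with recolouring-neighbour noMaximal u≢ε
  ... | w , w≢ε , u~w , w-differs =
    [ via-ε u≢ε v≢ε , via-neighbour u≢ε w≢ε v≢ε u~w ]′ (one-differs _ (w-differs ∘ sym))

  -- Walks of length 0 or 1 settle u = v and pairs involving ε.
  rainbow : (∀ x → ¬ IsMaximalInvolution G x) →
            IsRainbowColouring G 3 (colouring , λ x y _ → colouring-sym x y)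
  rainbow noMaximal u v with u ≟ v
  ... | yes refl = [] , []
  ... | no u≢v with u ≟ ε | v ≟ ε
  ...   | yes refl | _        = (u≢v , inj₁ (ε∈⟨⟩ v)) ∷ [] , [] ∷ []
  ...   | no _     | yes refl = (u≢v , inj₂ (ε∈⟨⟩ u)) ∷ [] , [] ∷ []
  ...   | no u≢ε   | no v≢ε   = rainbow-off-ε noMaximal u≢ε v≢ε

  rainbow-3 : (∀ x → ¬ IsMaximalInvolution G x) → RainbowColourable G 3
  rainbow-3 noMaximal = (colouring , λ x y _ → colouring-sym x y) , rainbow noMaximal

  module PrimeOrder (p : ℕ) (p-prime : Prime p) where

    -- a has order p; as p is prime, a ^ p = ε and a ≠ ε suffice.
    HasOrderₚ : El G → Set
    HasOrderₚ a = a ^ p ≡ ε × a ≢ ε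

    -- If a ^ p = ε, every non-identity c ∈ ⟨a⟩ generates ⟨a⟩: c = a ^ k with
    -- p ∤ k, and a Bézout relation between k and p expresses a as a power of c.
    generates : ∀ {a c} → a ^ p ≡ ε → c ∈⟨ a ⟩ → c ≢ ε → a ∈⟨ c ⟩
    generates {a} aᵖ≡ε (k , refl) aᵏ≢ε = from-Bézout (coprime-Bézout (prime∤⇒coprime p-prime p∤k))
      where
      p∤k : ¬ p ∣ k
      p∤k (divides q k≡qp) = aᵏ≢ε (trans (cong (a ^_) k≡qp) (^-period-* a q aᵖ≡ε))
      open ≡-Reasoning
      from-Bézout : Bézout.Identity 1 k p → a ∈⟨ a ^ k ⟩
      from-Bézout (Bézout.+- x y 1+yp≡xk) = x , (begin
        a                       ≡⟨ sym (identityʳ a) ⟩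
        a ∙ ε                   ≡⟨ cong (a ∙_) (sym (^-period-* a y aᵖ≡ε)) ⟩
        a ^ (1 + y * p)         ≡⟨ cong (a ^_) (trans 1+yp≡xk (*-comm x k)) ⟩
        a ^ (k * x)             ≡⟨ sym (^-* a k x) ⟩
        (a ^ k) ^ x             ∎)
      from-Bézout (Bézout.-+ x y 1+xk≡yp) =
        subst (_∈⟨ a ^ k ⟩) (sym (inverseˡ-unique a _ a∙[aᵏ]ˣ≡ε)) (∈⟨⟩-⁻¹ (x , refl))
        where
        a∙[aᵏ]ˣ≡ε : a ∙ ((a ^ k) ^ x) ≡ ε
        a∙[aᵏ]ˣ≡ε = begin
          a ∙ ((a ^ k) ^ x)     ≡⟨ cong (a ∙_) (^-* a k x) ⟩
          a ^ (1 + k * x)       ≡⟨ cong (a ^_) (trans (cong suc (*-comm k x)) 1+xk≡yp) ⟩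
          a ^ (y * p)           ≡⟨ ^-period-* a y aᵖ≡ε ⟩
          ε                     ∎

    ∉⟨⟩-sym : ∀ {a b} → b ^ p ≡ ε → a ≢ ε → ¬ b ∈⟨ a ⟩ → ¬ a ∈⟨ b ⟩
    ∉⟨⟩-sym bᵖ≡ε a≢ε b∉⟨a⟩ a∈⟨b⟩ = b∉⟨a⟩ (generates bᵖ≡ε a∈⟨b⟩ a≢ε)

    trivial-intersection : ∀ {a b z} → a ^ p ≡ ε → ¬ a ∈⟨ b ⟩ → z ∈⟨ a ⟩ → z ∈⟨ b ⟩ → z ≡ ε
    trivial-intersection {z = z} aᵖ≡ε a∉⟨b⟩ z∈⟨a⟩ z∈⟨b⟩ with z ≟ ε
    ... | yes z≡ε = z≡ε
    ... | no  z≢ε = ⊥-elim (a∉⟨b⟩ (∈⟨⟩-trans (generates aᵖ≡ε z∈⟨a⟩ z≢ε) z∈⟨b⟩))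

    -- A cyclic group ⟨w⟩ has at most one subgroup of order p: with a = w ^ i,
    -- b = w ^ j, the element c = w ^ gcd i j generates both a and b, and c ^ p = ε
    -- because p · gcd i j = gcd (p i) (p j) is a period of w.
    unique-in-cyclic : ∀ {w a b} → a ^ p ≡ ε → b ^ p ≡ ε → a ≢ ε → a ∈⟨ w ⟩ → b ∈⟨ w ⟩ → b ∈⟨ a ⟩
    unique-in-cyclic {w} aᵖ≡ε bᵖ≡ε a≢ε (i , refl) (j , refl) =
      ∈⟨⟩-trans (^∈⟨^divisor⟩ w (gcd[m,n]∣n i j)) (generates cᵖ≡ε (^∈⟨^divisor⟩ w (gcd[m,n]∣m i j)) a≢ε)
      where
      open ≡-Reasoning
      wᵖᵏ≡ε : ∀ k → (w ^ k) ^ p ≡ ε → w ^ (p * k) ≡ ε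
      wᵖᵏ≡ε k [wᵏ]ᵖ≡ε = trans (cong (w ^_) (*-comm p k)) (trans (sym (^-* w k p)) [wᵏ]ᵖ≡ε)
      cᵖ≡ε : (w ^ gcd i j) ^ p ≡ ε
      cᵖ≡ε = begin
        (w ^ gcd i j) ^ p        ≡⟨ ^-* w (gcd i j) p ⟩
        w ^ (gcd i j * p)        ≡⟨ cong (w ^_) (*-comm (gcd i j) p) ⟩
        w ^ (p * gcd i j)        ≡⟨ cong (w ^_) (c*gcd[m,n]≡gcd[cm,cn] p i j) ⟩
        w ^ gcd (p * i) (p * j)  ≡⟨ ^-gcd w (p * i) (p * j) (wᵖᵏ≡ε i aᵖ≡ε) (wᵖᵏ≡ε j bᵖ≡ε) ⟩
        ε                        ∎

    separated : ∀ {a b} → HasOrderₚ a → HasOrderₚ b → ¬ b ∈⟨ a ⟩ → Separated a b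
    separated {a} {b} (aᵖ≡ε , a≢ε) (bᵖ≡ε , _) b∉⟨a⟩ = a≢b , ¬a~b , only-ε
      where
      a∉⟨b⟩ : ¬ a ∈⟨ b ⟩
      a∉⟨b⟩ = ∉⟨⟩-sym bᵖ≡ε a≢ε b∉⟨a⟩
      a≢b : a ≢ b
      a≢b refl = b∉⟨a⟩ (∈⟨⟩-refl a)
      ¬a~b : ¬ PowerAdj G a b
      ¬a~b (_ , inj₁ a∈⟨b⟩) = a∉⟨b⟩ a∈⟨b⟩
      ¬a~b (_ , inj₂ b∈⟨a⟩) = b∉⟨a⟩ b∈⟨a⟩
      only-ε : ∀ w → PowerAdj G a w → PowerAdj G w b → w ≡ ε
      only-ε w (_ , inj₂ w∈⟨a⟩) (_ , inj₁ w∈⟨b⟩) = trivial-intersection aᵖ≡ε a∉⟨b⟩ w∈⟨a⟩ w∈⟨b⟩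
      only-ε w (_ , inj₁ a∈⟨w⟩) (_ , inj₁ w∈⟨b⟩) = ⊥-elim (a∉⟨b⟩ (∈⟨⟩-trans a∈⟨w⟩ w∈⟨b⟩))
      only-ε w (_ , inj₂ w∈⟨a⟩) (_ , inj₂ b∈⟨w⟩) = ⊥-elim (b∉⟨a⟩ (∈⟨⟩-trans b∈⟨w⟩ w∈⟨a⟩))
      only-ε w (_ , inj₁ a∈⟨w⟩) (_ , inj₂ b∈⟨w⟩) = ⊥-elim (b∉⟨a⟩ (unique-in-cyclic aᵖ≡ε bᵖ≡ε a≢ε a∈⟨w⟩ b∈⟨w⟩))

    order-p : ∀ {a c} → c ^ p ≡ ε → ¬ c ∈⟨ a ⟩ → HasOrderₚ c
    order-p cᵖ≡ε c∉⟨a⟩ = cᵖ≡ε , ∉⟨⟩⇒≢ε c∉⟨a⟩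

    conj-^p : ∀ a {b} → b ^ p ≡ ε → conj a b ^ p ≡ ε
    conj-^p a {b} bᵖ≡ε = trans (^-conj a b p) (trans (cong (conj a) bᵖ≡ε) (conj-ε a))

    -- If both conjugates a b a ⁻¹ ∈ ⟨b⟩ and b a b ⁻¹ ∈ ⟨a⟩, then a and b commute:
    -- the commutator lies in ⟨a⟩ ∩ ⟨b⟩ = {ε}.
    conjugates-commute : ∀ {a b} → a ^ p ≡ ε → ¬ a ∈⟨ b ⟩ →
                         conj a b ∈⟨ b ⟩ → conj b a ∈⟨ a ⟩ → a ∙ b ≡ b ∙ a
    conjugates-commute {a} {b} aᵖ≡ε a∉⟨b⟩ aba⁻¹∈⟨b⟩ bab⁻¹∈⟨a⟩ = begin
      a ∙ b         ≡⟨ sym (conj-∙ a b) ⟩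
      conj a b ∙ a  ≡⟨ cong (_∙ a) (x∙y⁻¹≈ε⇒x≈y _ _ commutator≡ε) ⟩
      b ∙ a         ∎
      where
      open ≡-Reasoning
      commutator≡ε : conj a b ∙ (b ⁻¹) ≡ ε
      commutator≡ε = trivial-intersection aᵖ≡ε a∉⟨b⟩
        (subst (_∈⟨ a ⟩) (sym (commutator a b)) (∈⟨⟩-∙ (∈⟨⟩-refl a) (∈⟨⟩-⁻¹ bab⁻¹∈⟨a⟩)))
        (∈⟨⟩-∙ aba⁻¹∈⟨b⟩ (⁻¹∈⟨⟩ b))

    -- Given elements a, b of order p with ⟨a⟩ ≠ ⟨b⟩, some element of order p lies
    -- in neither: the conjugate a b a ⁻¹ or b a b ⁻¹, or, if both fail, the product
    -- a b of the then commuting a and b.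
    third : ∀ {a b} → HasOrderₚ a → HasOrderₚ b → ¬ b ∈⟨ a ⟩ →
            ∃ λ c → HasOrderₚ c × ¬ c ∈⟨ a ⟩ × ¬ c ∈⟨ b ⟩
    third {a} {b} (aᵖ≡ε , a≢ε) (bᵖ≡ε , _) b∉⟨a⟩ with conj a b ∈⟨ b ⟩? | conj b a ∈⟨ a ⟩?
    ... | no aba⁻¹∉⟨b⟩ | _ =
      conj a b , order-p (conj-^p a bᵖ≡ε) (b∉⟨a⟩ ∘ conj-∈⟨⟩) , b∉⟨a⟩ ∘ conj-∈⟨⟩ , aba⁻¹∉⟨b⟩
    ... | yes _ | no bab⁻¹∉⟨a⟩ =
      conj b a , order-p (conj-^p b aᵖ≡ε) bab⁻¹∉⟨a⟩ , bab⁻¹∉⟨a⟩ , ∉⟨⟩-sym bᵖ≡ε a≢ε b∉⟨a⟩ ∘ conj-∈⟨⟩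
    ... | yes aba⁻¹∈⟨b⟩ | yes bab⁻¹∈⟨a⟩ =
      a ∙ b , order-p [ab]ᵖ≡ε ab∉⟨a⟩ , ab∉⟨a⟩ , ∉⟨⟩-sym bᵖ≡ε a≢ε b∉⟨a⟩ ∘ ∈⟨⟩-cancelʳ
      where
      ab∉⟨a⟩ : ¬ (a ∙ b) ∈⟨ a ⟩
      ab∉⟨a⟩ = b∉⟨a⟩ ∘ ∈⟨⟩-cancelˡ
      [ab]ᵖ≡ε : (a ∙ b) ^ p ≡ ε
      [ab]ᵖ≡ε = begin
        (a ∙ b) ^ p          ≡⟨ ^-∙-commuting a b ab≡ba p ⟩
        (a ^ p) ∙ (b ^ p)    ≡⟨ cong₂ _∙_ aᵖ≡ε bᵖ≡ε ⟩
        ε ∙ ε                ≡⟨ identityˡ ε ⟩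
        ε                    ∎
        where
        open ≡-Reasoning
        ab≡ba : a ∙ b ≡ b ∙ a
        ab≡ba = conjugates-commute aᵖ≡ε (∉⟨⟩-sym bᵖ≡ε a≢ε b∉⟨a⟩) aba⁻¹∈⟨b⟩ bab⁻¹∈⟨a⟩

    -- Two different subgroups S, T of order p contain a ∈ S ∖ T and b ∈ T ∖ S,
    -- both of order p by Lagrange; and b ∉ ⟨a⟩ ⊆ S.
    from-two-subgroups : ∀ {S T} → IsSubgroupOfOrder G p S → IsSubgroupOfOrder G p T → S ≢ T →
                         ∃ λ a → ∃ λ b → HasOrderₚ a × HasOrderₚ b × ¬ b ∈⟨ a ⟩
    from-two-subgroups {S} {T} (S≤G , ∣S∣≡p) (T≤G , ∣T∣≡p) S≢T
      with outside-element S T (trans ∣S∣≡p (sym ∣T∣≡p)) S≢T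
         | outside-element T S (trans ∣T∣≡p (sym ∣S∣≡p)) (S≢T ∘ sym)
    ... | a , a∈S , a∉T | b , b∈T , b∉S = a , b , order-p-in S≤G ∣S∣≡p a∈S T≤G a∉T ,
      order-p-in T≤G ∣T∣≡p b∈T S≤G b∉S , λ (k , b≡aᵏ) → b∉S (subst (_∈ S) (sym b≡aᵏ) (^∈subgroup S≤G a∈S k))
      where
      order-p-in : ∀ {U V x} → IsSubgroup G U → ∣ U ∣ ≡ p → x ∈ U → IsSubgroup G V → x ∉ V → HasOrderₚ x
      order-p-in U≤G ∣U∣≡p x∈U (ε∈V , _) x∉V =
        subst (λ n → _ ^ n ≡ ε) ∣U∣≡p (lagrange U≤G x∈U) , λ { refl → x∉V ε∈V }

    -- Lower bound: two different subgroups of order p yield elements a, b, c of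
    -- order p generating pairwise different subgroups, hence three pairwise
    -- separated vertices, so rc(Γ_G) ≥ 3.
    no-rainbow-below-3ₚ : ∀ {S T} → IsSubgroupOfOrder G p S → IsSubgroupOfOrder G p T → S ≢ T →
                          ∀ k → k < 3 → ¬ RainbowColourable G k
    no-rainbow-below-3ₚ S≤G T≤G S≢T = from-pair (from-two-subgroups S≤G T≤G S≢T)
      where
      from-pair : (∃ λ a → ∃ λ b → HasOrderₚ a × HasOrderₚ b × ¬ b ∈⟨ a ⟩) →
                  ∀ k → k < 3 → ¬ RainbowColourable G k
      from-pair (a , b , a-order , b-order , b∉⟨a⟩) with third a-order b-order b∉⟨a⟩
      ... | c , c-order , c∉⟨a⟩ , c∉⟨b⟩ =
        no-rainbow-below-3 (separated a-order b-order b∉⟨a⟩) (separated b-order c-order c∉⟨b⟩)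
                           (separated a-order c-order c∉⟨a⟩)

proposition3p6 : (G : FiniteGroup) →
    ¬ IsCyclic G →
    (∀ x → ¬ IsMaximalInvolution G x) →
    (∃[ p ] (Prime p × p ∣ FiniteGroup.order G ×
      (∃[ S ] ∃[ T ] (IsSubgroupOfOrder G p S × IsSubgroupOfOrder G p T × S ≢ T)))) →
    RainbowConnectionNumber G 3
proposition3p6 G _ noMaximal (p , p-prime , _ , S , T , S≤G , T≤G , S≢T) =
  rainbow-3 G noMaximal , PrimeOrder.no-rainbow-below-3ₚ G p p-prime S≤G T≤G S≢T
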